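{- Let $\mathbb V=\{\sum_{i=1}^n\alpha_i\cdot\lambda x_i.\mathbf t_i+\sum_{j=n+1}^m\lambda x_j.\mathbf t_j \mid \lambda x_i.\mathbf t_i\neq\lambda x_j.\mathbf t_j \text{ for all } i,j\}$ and let $\mathsf{NF}$ be the set of terms in normal form (terms $\mathbf t$ with no $\mathbf t'$ such that $\mathbf t\to\mathbf t'$). If $\vdash\mathbf t:T$ is derivable in $\lambda^{\mathrm{vec}}_{\mathrm R}$ with the empty context and $\mathbf t\in\mathsf{NF}$, then $\mathbf t\in\mathbb V$.
   Context: Fix a commutative ring $(\mathsf S,+,\times)$ of scalars. Terms: $\mathbf t ::= x\mid \lambda x.\mathbf t\mid (\mathbf t)\,\mathbf t\mid \alpha\cdot\mathbf t\mid \mathbf t+\mathbf t$, $\alpha\in\mathsf S$. Basis terms: $\mathbf b ::= x\mid\lambda x.\mathbf t$. The one-step reduction $\to$ is the closure under the contexts $\alpha\cdot[-]$, $\mathbf u+[-]$, $(\mathbf u)\,[-]$, $([-])\,\mathbf u$, $\lambda x.[-]$ of: $1\cdot\mathbf t\to\mathbf t$; $\alpha\cdot(\beta\cdot\mathbf t)\to(\alpha\times\beta)\cdot\mathbf t$; $\alpha\cdot(\mathbf t+\mathbf r)\to\alpha\cdot\mathbf t+\alpha\cdot\mathbf r$; $\alpha\cdot\mathbf t+\beta\cdot\mathbf t\to(\alpha+\beta)\cdot\mathbf t$; $\alpha\cdot\mathbf t+\mathbf t\to(\alpha+1)\cdot\mathbf t$; $\mathbf t+\mathbf t\to(1+1)\cdot\mathbf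 t$; $(\mathbf t+\mathbf r)\,\mathbf u\to(\mathbf t)\,\mathbf u+(\mathbf r)\,\mathbf u$; $(\mathbf t)\,(\mathbf r+\mathbf u)\to(\mathbf t)\,\mathbf r+(\mathbf t)\,\mathbf u$; $(\alpha\cdot\mathbf t)\,\mathbf r\to\alpha\cdot(\mathbf t)\,\mathbf r$; $(\mathbf t)\,(\alpha\cdot\mathbf r)\to\alpha\cdot(\mathbf t)\,\mathbf r$; $(\lambda x.\mathbf t)\,\mathbf b\to\mathbf t[\mathbf b/x]$ for basis terms $\mathbf b$. Types: general $T::=U\mid\alpha\cdot T\mid T+T\mid\mathbb X$, unit $U::=X\mid U\to T\mid\forall X.U\mid\forall\mathbb X.U$ ($X$ unit type variables, $\mathbb X$ general type variables). $\equiv$ is the smallest congruence with $1\cdot T\equiv T$, $\alpha\cdot(\beta\cdot T)\equiv(\alpha\times\beta)\cdot T$, $\alpha\cdot T+\alpha\cdot R\equiv\alpha\cdot(T+R)$, $\alpha\cdot T+\beta\cdot T\equiv(\alpha+\beta)\cdot T$, $T+R\equiv R+T$, $T+(R+S)\equiv(T+R)+S$. In $T[A/X]$, $A$ is unit when $X$ is a unit variable. Contexts are finite sets of $x:U$ with $U$ unit. Typing rules: (ax) $\Gamma,x:U\vdash x:U$; ($\equiv$) from $\Gamma\vdash\mathbf t:T$, $R\equiv T$ infer $\Gamma\vdash\mathbf t:R$; ($\to_I$) from $\Gamma,x:U\vdash\mathbf t:T$ infer $\Gamma\vdash\lambda x.\mathbf t:U\to T$; ($\to_E$) from $\Gamma\vdash\mathbf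 t:\sum_{i=1}^n\alpha_i\cdot\forall\vec X.(U\to T_i)$ and $\Gamma\vdash\mathbf r:\sum_{j=1}^m\beta_j\cdot U[\vec A_j/\vec X]$ infer $\Gamma\vdash(\mathbf t)\,\mathbf r:\sum_{i}\sum_{j}(\alpha_i\times\beta_j)\cdot T_i[\vec A_j/\vec X]$; ($\forall_I$) from $\Gamma\vdash\mathbf t:\sum_i\alpha_i\cdot U_i$, $X\notin FV(\Gamma)$ infer $\Gamma\vdash\mathbf t:\sum_i\alpha_i\cdot\forall X.U_i$; ($\forall_E$) from $\Gamma\vdash\mathbf t:\sum_i\alpha_i\cdot\forall X.U_i$ infer $\Gamma\vdash\mathbf t:\sum_i\alpha_i\cdot U_i[A/X]$; ($+_I$) from $\Gamma\vdash\mathbf t:T$, $\Gamma\vdash\mathbf r:R$ infer $\Gamma\vdash\mathbf t+\mathbf r:T+R$; ($1_E$) from $\Gamma\vdash1\cdot\mathbf t:T$ infer $\Gamma\vdash\mathbf t:T$; ($S$) from $\Gamma\vdash\mathbf t:T_i$ for all $i\in\{1,\dots,n\}$ infer $\Gamma\vdash(\sum_i\alpha_i)\cdot\mathbf t:\sum_i\alpha_i\cdot T_i$. -}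

open import Algebra.Bundles using (CommutativeRing)

module Defs where

module Lvec {c ℓ} (R : CommutativeRing c ℓ) where

  open import Data.Nat using (ℕ; zero; suc; _<ᵇ_; _≡ᵇ_; pred)
  open import Data.Bool using (if_then_else_)
  open import Data.Fin using (Fin; zero; suc)
  open import Data.List using (List; []; _∷_; _++_; [_]; map)
  open import Data.Product using (Σ; _×_)
  open import Data.List.Relation.Binary.Pointwise using (Pointwise)
  open import Data.List.Relation.Unary.AllPairs using (AllPairs)
  open import Relation.Nullary using (¬_)
  open import Function using (_∘_)

  open CommutativeRing R using ()
    renaming (Carrier to S; _+_ to _+ₛ_; _*_ to _*ₛ_; 1# to 1ₛ)

  -- Terms (de Bruijn indices; so terms are taken up to alpha-conversion)

  infixl 6 _⊕_
  infixr 7 _⊙_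

  data Term : Set c where
    var : ℕ → Term
    lam : Term → Term
    app : Term → Term → Term
    _⊙_ : S → Term → Term
    _⊕_ : Term → Term → Term

  data Basis : Term → Set c where
    bvar : ∀ n → Basis (var n)
    blam : ∀ t → Basis (lam t)

  shift : ℕ → Term → Term
  shift k (var n)   = if n <ᵇ k then var n else var (suc n)
  shift k (lam t)   = lam (shift (suc k) t)
  shift k (app t r) = app (shift k t) (shift k r)
  shift k (α ⊙ t)   = α ⊙ shift k t
  shift k (t ⊕ r)   = shift k t ⊕ shift k r

  subst : ℕ → Term → Term → Term
  subst j s (var n)   = if n ≡ᵇ j then s else (if j <ᵇ n then var (pred n) else var n)
  subst j s (lam t)   = lam (subst (suc j) (shift 0 s) t)
  subst j s (app t r) = app (subst j s t) (subst j s r)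
  subst j s (α ⊙ t)   = α ⊙ subst j s t
  subst j s (t ⊕ r)   = subst j s t ⊕ subst j s r

  _[_/0] : Term → Term → Term
  t [ b /0] = subst 0 b t

  infix 4 _~_
  data _~_ : Term → Term → Set c where
    ~refl  : ∀ {t} → t ~ t
    ~sym   : ∀ {t r} → t ~ r → r ~ t
    ~trans : ∀ {t r u} → t ~ r → r ~ u → t ~ u
    ~comm  : ∀ {t r} → (t ⊕ r) ~ (r ⊕ t)
    ~assoc : ∀ {t r u} → (t ⊕ (r ⊕ u)) ~ ((t ⊕ r) ⊕ u)
    ~lam   : ∀ {t t'} → t ~ t' → lam t ~ lam t'
    ~app   : ∀ {t t' r r'} → t ~ t' → r ~ r' → app t r ~ app t' r'
    ~sc    : ∀ {α t t'} → t ~ t' → (α ⊙ t) ~ (α ⊙ t')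
    ~plus  : ∀ {t t' r r'} → t ~ t' → r ~ r' → (t ⊕ r) ~ (t' ⊕ r')

  infix 4 _↦_
  data _↦_ : Term → Term → Set c where
    r-one    : ∀ {t} → (1ₛ ⊙ t) ↦ t
    r-scsc   : ∀ {α β t} → (α ⊙ (β ⊙ t)) ↦ ((α *ₛ β) ⊙ t)
    r-scdist : ∀ {α t r} → (α ⊙ (t ⊕ r)) ↦ ((α ⊙ t) ⊕ (α ⊙ r))
    r-fact   : ∀ {α β t} → ((α ⊙ t) ⊕ (β ⊙ t)) ↦ ((α +ₛ β) ⊙ t)
    r-fact1  : ∀ {α t} → ((α ⊙ t) ⊕ t) ↦ ((α +ₛ 1ₛ) ⊙ t)
    r-fact2  : ∀ {t} → (t ⊕ t) ↦ ((1ₛ +ₛ 1ₛ) ⊙ t)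
    r-distl  : ∀ {t r u} → app (t ⊕ r) u ↦ (app t u ⊕ app r u)
    r-distr  : ∀ {t r u} → app t (r ⊕ u) ↦ (app t r ⊕ app t u)
    r-scl    : ∀ {α t r} → app (α ⊙ t) r ↦ (α ⊙ app t r)
    r-scr    : ∀ {α t r} → app t (α ⊙ r) ↦ (α ⊙ app t r)
    r-beta   : ∀ {t b} → Basis b → app (lam t) b ↦ (t [ b /0])
    c-sc     : ∀ {α t t'} → t ↦ t' → (α ⊙ t) ↦ (α ⊙ t')
    c-plus   : ∀ {u t t'} → t ↦ t' → (u ⊕ t) ↦ (u ⊕ t')
    c-appr   : ∀ {u t t'} → t ↦ t' → app u t ↦ app u t'
    c-appl   : ∀ {u t t'} → t ↦ t' → app t u ↦ app t' u
    c-lam    : ∀ {t t'} → t ↦ t' → lam t ↦ lam t'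

  infix 4 _⟶_
  _⟶_ : Term → Term → Set c
  t ⟶ t' = Σ Term λ t₁ → Σ Term λ t₂ → (t ~ t₁) × (t₁ ↦ t₂) × (t₂ ~ t')

  NF : Term → Set c
  NF t = ∀ t' → ¬ (t ⟶ t')

  -- The set V of values:
  --   sum_{i≤n} α_i·λx_i.t_i + sum_{n<j≤m} λx_j.t_j  with the λx_i.t_i
  --   pairwise distinct (as terms, i.e. modulo AC and alpha).

  summands : Term → List Term
  summands (t ⊕ r) = summands t ++ summands r
  summands t       = [ t ]

  data Summand : Term → Term → Set c where
    scaled : ∀ α s → Summand (α ⊙ lam s) (lam s)
    plain  : ∀ s → Summand (lam s) (lam s)

  InV : Term → Set c
  InV t = Σ (List Term) λ abs →
    Pointwise Summand (summands t) abs × AllPairs (λ a b → ¬ (a ~ b)) abs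

  -- Types.  Unit and general type variables live in two separate
  -- de Bruijn index spaces; ∀u binds a unit variable, ∀g a general one.

  infixr 5 _⇒_
  infixl 6 _⊞_
  infixr 7 _⊛_

  mutual
    data Ty : Set c where
      unit : UTy → Ty
      _⊛_  : S → Ty → Ty
      _⊞_  : Ty → Ty → Ty
      gv   : ℕ → Ty

    data UTy : Set c where
      uv  : ℕ → UTy
      _⇒_ : UTy → Ty → UTy
      ∀u  : UTy → UTy
      ∀g  : UTy → UTy

  mutual
    shUU : ℕ → UTy → UTy
    shUU k (uv n)  = if n <ᵇ k then uv n else uv (suc n)
    shUU k (U ⇒ T) = shUU k U ⇒ shUT k T
    shUU k (∀u U)  = ∀u (shUU (suc k) U)
    shUU k (∀g U)  = ∀g (shUU k U)

    shUT : ℕ → Ty → Ty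
    shUT k (unit U) = unit (shUU k U)
    shUT k (α ⊛ T)  = α ⊛ shUT k T
    shUT k (T ⊞ T') = shUT k T ⊞ shUT k T'
    shUT k (gv n)   = gv n

  mutual
    shGU : ℕ → UTy → UTy
    shGU k (uv n)  = uv n
    shGU k (U ⇒ T) = shGU k U ⇒ shGT k T
    shGU k (∀u U)  = ∀u (shGU k U)
    shGU k (∀g U)  = ∀g (shGU (suc k) U)

    shGT : ℕ → Ty → Ty
    shGT k (unit U) = unit (shGU k U)
    shGT k (α ⊛ T)  = α ⊛ shGT k T
    shGT k (T ⊞ T') = shGT k T ⊞ shGT k T'
    shGT k (gv n)   = if n <ᵇ k then gv n else gv (suc n)

  mutual
    sbUU : ℕ → UTy → UTy → UTy
    sbUU j A (uv n)  = if n ≡ᵇ j then A else (if j <ᵇ n then uv (pred n) else uv n)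
    sbUU j A (U ⇒ T) = sbUU j A U ⇒ sbUT j A T
    sbUU j A (∀u U)  = ∀u (sbUU (suc j) (shUU 0 A) U)
    sbUU j A (∀g U)  = ∀g (sbUU j (shGU 0 A) U)

    sbUT : ℕ → UTy → Ty → Ty
    sbUT j A (unit U) = unit (sbUU j A U)
    sbUT j A (α ⊛ T)  = α ⊛ sbUT j A T
    sbUT j A (T ⊞ T') = sbUT j A T ⊞ sbUT j A T'
    sbUT j A (gv n)   = gv n

  mutual
    sbGU : ℕ → Ty → UTy → UTy
    sbGU j B (uv n)  = uv n
    sbGU j B (U ⇒ T) = sbGU j B U ⇒ sbGT j B T
    sbGU j B (∀u U)  = ∀u (sbGU j (shUT 0 B) U)
    sbGU j B (∀g U)  = ∀g (sbGU (suc j) (shGT 0 B) U)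

    sbGT : ℕ → Ty → Ty → Ty
    sbGT j B (unit U) = unit (sbGU j B U)
    sbGT j B (α ⊛ T)  = α ⊛ sbGT j B T
    sbGT j B (T ⊞ T') = sbGT j B T ⊞ sbGT j B T'
    sbGT j B (gv n)   = if n ≡ᵇ j then B else (if j <ᵇ n then gv (pred n) else gv n)

  -- Vectors of type variables ∀X⃗ : a list of binder sorts (outermost first)
  data Sort : Set where
    unitS genS : Sort

  ∀* : List Sort → UTy → UTy
  ∀* []            U = U
  ∀* (unitS ∷ ks) U = ∀u (∀* ks U)
  ∀* (genS ∷ ks)  U = ∀g (∀* ks U)

  data Args : List Sort → Set c where
    []   : Args []
    _∷ᵘ_ : ∀ {ks} → UTy → Args ks → Args (unitS ∷ ks)
    _∷ᵍ_ : ∀ {ks} → Ty → Args ks → Args (genS ∷ ks)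

  count : Sort → List Sort → ℕ
  count k [] = 0
  count unitS (unitS ∷ ks) = suc (count unitS ks)
  count unitS (genS ∷ ks)  = count unitS ks
  count genS  (unitS ∷ ks) = count genS ks
  count genS  (genS ∷ ks)  = suc (count genS ks)

  iter : {A : Set c} → ℕ → (A → A) → A → A
  iter zero    f a = a
  iter (suc n) f a = f (iter n f a)

  liftU : List Sort → UTy → UTy
  liftU ks A = iter (count unitS ks) (shUU 0) (iter (count genS ks) (shGU 0) A)

  liftT : List Sort → Ty → Ty
  liftT ks B = iter (count unitS ks) (shUT 0) (iter (count genS ks) (shGT 0) B)

  -- V[A⃗/X⃗] for V living under the binders X⃗ = ks (simultaneous substitution)
  instU : (ks : List Sort) → Args ks → UTy → UTy
  instU []            []        V = V
  instU (unitS ∷ ks) (A ∷ᵘ As) V = instU ks As (sbUU (count unitS ks) (liftU ks A) V)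
  instU (genS ∷ ks)  (B ∷ᵍ As) V = instU ks As (sbGU (count genS ks) (liftT ks B) V)

  instT : (ks : List Sort) → Args ks → Ty → Ty
  instT []            []        V = V
  instT (unitS ∷ ks) (A ∷ᵘ As) V = instT ks As (sbUT (count unitS ks) (liftU ks A) V)
  instT (genS ∷ ks)  (B ∷ᵍ As) V = instT ks As (sbGT (count genS ks) (liftT ks B) V)

  ΣT : ∀ {n} → (Fin (suc n) → Ty) → Ty
  ΣT {zero}  f = f zero
  ΣT {suc n} f = f zero ⊞ ΣT (f ∘ suc)

  ΣS : ∀ {n} → (Fin (suc n) → S) → S
  ΣS {zero}  f = f zero
  ΣS {suc n} f = f zero +ₛ ΣS (f ∘ suc)

  infix 4 _≡ₜ_
  data _≡ₜ_ : Ty → Ty → Set c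
  data _≡ᵤ_ : UTy → UTy → Set c

  data _≡ₜ_ where
    t-refl   : ∀ {T} → T ≡ₜ T
    t-sym    : ∀ {T R'} → T ≡ₜ R' → R' ≡ₜ T
    t-trans  : ∀ {T R' S'} → T ≡ₜ R' → R' ≡ₜ S' → T ≡ₜ S'
    t-one    : ∀ {T} → (1ₛ ⊛ T) ≡ₜ T
    t-scsc   : ∀ {α β T} → (α ⊛ (β ⊛ T)) ≡ₜ ((α *ₛ β) ⊛ T)
    t-dist   : ∀ {α T R'} → ((α ⊛ T) ⊞ (α ⊛ R')) ≡ₜ (α ⊛ (T ⊞ R'))
    t-fact   : ∀ {α β T} → ((α ⊛ T) ⊞ (β ⊛ T)) ≡ₜ ((α +ₛ β) ⊛ T)
    t-comm   : ∀ {T R'} → (T ⊞ R') ≡ₜ (R' ⊞ T)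
    t-assoc  : ∀ {T R' S'} → (T ⊞ (R' ⊞ S')) ≡ₜ ((T ⊞ R') ⊞ S')
    t-unit   : ∀ {U U'} → U ≡ᵤ U' → unit U ≡ₜ unit U'
    t-sc     : ∀ {α T T'} → T ≡ₜ T' → (α ⊛ T) ≡ₜ (α ⊛ T')
    t-plus   : ∀ {T T' R' R''} → T ≡ₜ T' → R' ≡ₜ R'' → (T ⊞ R') ≡ₜ (T' ⊞ R'')

  data _≡ᵤ_ where
    u-refl  : ∀ {U} → U ≡ᵤ U
    u-sym   : ∀ {U U'} → U ≡ᵤ U' → U' ≡ᵤ U
    u-trans : ∀ {U U' U''} → U ≡ᵤ U' → U' ≡ᵤ U'' → U ≡ᵤ U''
    u-arr   : ∀ {U U' T T'} → U ≡ᵤ U' → T ≡ₜ T' → (U ⇒ T) ≡ᵤ (U' ⇒ T')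
    u-∀u    : ∀ {U U'} → U ≡ᵤ U' → ∀u U ≡ᵤ ∀u U'
    u-∀g    : ∀ {U U'} → U ≡ᵤ U' → ∀g U ≡ᵤ ∀g U'

  Ctx : Set c
  Ctx = List UTy

  data _∋_∶_ : Ctx → ℕ → UTy → Set c where
    here  : ∀ {Γ U} → (U ∷ Γ) ∋ 0 ∶ U
    there : ∀ {Γ U V n} → Γ ∋ n ∶ U → (V ∷ Γ) ∋ suc n ∶ U

  infix 3 _⊢_∶_
  data _⊢_∶_ : Ctx → Term → Ty → Set c where
    ax   : ∀ {Γ n U} → Γ ∋ n ∶ U → Γ ⊢ var n ∶ unit U
    conv : ∀ {Γ t T R'} → Γ ⊢ t ∶ T → R' ≡ₜ T → Γ ⊢ t ∶ R'
    →I   : ∀ {Γ U t T} → (U ∷ Γ) ⊢ t ∶ T → Γ ⊢ lam t ∶ unit (U ⇒ T)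
    →E   : ∀ {Γ t r n m} {α : Fin (suc n) → S} {ks : List Sort} {U : UTy}
             {T : Fin (suc n) → Ty} {β : Fin (suc m) → S} {A : Fin (suc m) → Args ks}
           → Γ ⊢ t ∶ ΣT (λ i → α i ⊛ unit (∀* ks (U ⇒ T i)))
           → Γ ⊢ r ∶ ΣT (λ j → β j ⊛ unit (instU ks (A j) U))
           → Γ ⊢ app t r ∶ ΣT (λ i → ΣT (λ j → (α i *ₛ β j) ⊛ instT ks (A j) (T i)))
    ∀Iu  : ∀ {Γ t n} {α : Fin (suc n) → S} {U : Fin (suc n) → UTy}
           → map (shUU 0) Γ ⊢ t ∶ ΣT (λ i → α i ⊛ unit (U i))
           → Γ ⊢ t ∶ ΣT (λ i → α i ⊛ unit (∀u (U i)))
    ∀Ig  : ∀ {Γ t n} {α : Fin (suc n) → S} {U : Fin (suc n) → UTy}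
           → map (shGU 0) Γ ⊢ t ∶ ΣT (λ i → α i ⊛ unit (U i))
           → Γ ⊢ t ∶ ΣT (λ i → α i ⊛ unit (∀g (U i)))
    ∀Eu  : ∀ {Γ t n} {α : Fin (suc n) → S} {U : Fin (suc n) → UTy} (A : UTy)
           → Γ ⊢ t ∶ ΣT (λ i → α i ⊛ unit (∀u (U i)))
           → Γ ⊢ t ∶ ΣT (λ i → α i ⊛ unit (sbUU 0 A (U i)))
    ∀Eg  : ∀ {Γ t n} {α : Fin (suc n) → S} {U : Fin (suc n) → UTy} (B : Ty)
           → Γ ⊢ t ∶ ΣT (λ i → α i ⊛ unit (∀g (U i)))
           → Γ ⊢ t ∶ ΣT (λ i → α i ⊛ unit (sbGU 0 B (U i)))
    +I   : ∀ {Γ t r T R'} → Γ ⊢ t ∶ T → Γ ⊢ r ∶ R' → Γ ⊢ t ⊕ r ∶ T ⊞ R'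
    1E   : ∀ {Γ t T} → Γ ⊢ 1ₛ ⊙ t ∶ T → Γ ⊢ t ∶ T
    SI   : ∀ {Γ t n} {α : Fin (suc n) → S} {T : Fin (suc n) → Ty}
           → (∀ i → Γ ⊢ t ∶ T i)
           → Γ ⊢ ΣS α ⊙ t ∶ ΣT (λ i → α i ⊛ T i)

-- A term typable in the empty context has no variable outside the bodies of its
-- abstractions, and every such normal form is a value, by induction on the term.
-- An application of two values always contains a redex (distribution over a sum,
-- extraction of a scalar, or β on an abstraction); a scalar multiple of a value is
-- normal only if the value is a bare abstraction; and if two values contain
-- AC-equivalent abstractions, their sum exposes a factorisation redex once the two
-- summands are brought next to each other modulo AC.
module Submission where

open import Defs
open import Algebra.Bundles using (CommutativeRing)
open import Relation.Binary.PropositionalEquality using (_≡_; refl)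
open import Data.List using ([]; _∷_)
open import Data.Product using (∃; _,_; _×_)
open import Data.Sum using (inj₁; inj₂)
open import Data.Empty using (⊥; ⊥-elim)
open import Data.Unit using (⊤)
open import Data.Fin using (zero)
open import Relation.Nullary using (¬_)
open import Data.List.Membership.Propositional using (_∈_)
open import Data.List.Relation.Unary.Any using (here; there)
open import Data.List.Relation.Unary.Any.Properties using (++⁻)
import Data.List.Relation.Unary.All as All
open import Data.List.Relation.Binary.Pointwise as Pointwise using (Pointwise; []; _∷_)
open import Data.List.Relation.Unary.AllPairs using ([]; _∷_)
import Data.List.Relation.Unary.AllPairs.Properties as AllPairs

∈-Pointwiseʳ : ∀ {a b r} {A : Set a} {B : Set b} {_∼_ : A → B → Set r} {xs ys y} →
               Pointwise _∼_ xs ys → y ∈ ys → ∃ λ x → x ∈ xs × x ∼ y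
∈-Pointwiseʳ (x∼y ∷ _)   (here refl) = _ , here refl , x∼y
∈-Pointwiseʳ (_ ∷ xs∼ys) (there y∈) with ∈-Pointwiseʳ xs∼ys y∈
... | x , x∈ , x∼y = x , there x∈ , x∼y

module Values {c ℓ} (R : CommutativeRing c ℓ) where
  open Lvec R

  -- The part of closedness that matters for normal forms.
  BuiltFromAbs : Term → Set
  BuiltFromAbs (var n)   = ⊥
  BuiltFromAbs (lam t)   = ⊤
  BuiltFromAbs (app t r) = BuiltFromAbs t × BuiltFromAbs r
  BuiltFromAbs (α ⊙ t)   = BuiltFromAbs t
  BuiltFromAbs (t ⊕ r)   = BuiltFromAbs t × BuiltFromAbs r

  ⊢[]⇒BuiltFromAbs : ∀ {t T} → [] ⊢ t ∶ T → BuiltFromAbs t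
  ⊢[]⇒BuiltFromAbs (ax ())
  ⊢[]⇒BuiltFromAbs (conv d _) = ⊢[]⇒BuiltFromAbs d
  ⊢[]⇒BuiltFromAbs (→I _)     = _
  ⊢[]⇒BuiltFromAbs (→E d e)   = ⊢[]⇒BuiltFromAbs d , ⊢[]⇒BuiltFromAbs e
  ⊢[]⇒BuiltFromAbs (∀Iu d)    = ⊢[]⇒BuiltFromAbs d
  ⊢[]⇒BuiltFromAbs (∀Ig d)    = ⊢[]⇒BuiltFromAbs d
  ⊢[]⇒BuiltFromAbs (∀Eu _ d)  = ⊢[]⇒BuiltFromAbs d
  ⊢[]⇒BuiltFromAbs (∀Eg _ d)  = ⊢[]⇒BuiltFromAbs d
  ⊢[]⇒BuiltFromAbs (+I d e)   = ⊢[]⇒BuiltFromAbs d , ⊢[]⇒BuiltFromAbs e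
  ⊢[]⇒BuiltFromAbs (1E d)     = ⊢[]⇒BuiltFromAbs d
  ⊢[]⇒BuiltFromAbs (SI d)     = ⊢[]⇒BuiltFromAbs (d zero)

  Reducible : Term → Set c
  Reducible t = ∃ λ t' → t ⟶ t'

  Reducible⇒¬NF : ∀ {t} → Reducible t → ¬ NF t
  Reducible⇒¬NF (t' , t⟶t') nf = nf t' t⟶t'

  ↦⇒Reducible : ∀ {t t'} → t ↦ t' → Reducible t
  ↦⇒Reducible t↦t' = _ , _ , _ , ~refl , t↦t' , ~refl

  Reducible-resp-~ : ∀ {t t'} → t ~ t' → Reducible t' → Reducible t
  Reducible-resp-~ t~t' (u , t₁ , t₂ , t'~t₁ , t₁↦t₂ , t₂~u) =
    u , t₁ , t₂ , ~trans t~t' t'~t₁ , t₁↦t₂ , t₂~u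

  ⟶-⊕ʳ : ∀ {u t t'} → t ⟶ t' → u ⊕ t ⟶ u ⊕ t'
  ⟶-⊕ʳ (t₁ , t₂ , t~t₁ , t₁↦t₂ , t₂~t') =
    _ , _ , ~plus ~refl t~t₁ , c-plus t₁↦t₂ , ~plus ~refl t₂~t'

  ⟶-⊕ˡ : ∀ {u t t'} → t ⟶ t' → t ⊕ u ⟶ t' ⊕ u
  ⟶-⊕ˡ (t₁ , t₂ , t~t₁ , t₁↦t₂ , t₂~t') =
    _ , _ , ~trans ~comm (~plus ~refl t~t₁) , c-plus t₁↦t₂ , ~trans (~plus ~refl t₂~t') ~comm

  ⟶-⊙ : ∀ {α t t'} → t ⟶ t' → α ⊙ t ⟶ α ⊙ t'
  ⟶-⊙ (t₁ , t₂ , t~t₁ , t₁↦t₂ , t₂~t') = _ , _ , ~sc t~t₁ , c-sc t₁↦t₂ , ~sc t₂~t'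

  ⟶-appˡ : ∀ {u t t'} → t ⟶ t' → app t u ⟶ app t' u
  ⟶-appˡ (t₁ , t₂ , t~t₁ , t₁↦t₂ , t₂~t') =
    _ , _ , ~app t~t₁ ~refl , c-appl t₁↦t₂ , ~app t₂~t' ~refl

  ⟶-appʳ : ∀ {u t t'} → t ⟶ t' → app u t ⟶ app u t'
  ⟶-appʳ (t₁ , t₂ , t~t₁ , t₁↦t₂ , t₂~t') =
    _ , _ , ~app ~refl t~t₁ , c-appr t₁↦t₂ , ~app ~refl t₂~t'

  NF-⊕ˡ : ∀ {t r} → NF (t ⊕ r) → NF t
  NF-⊕ˡ nf _ t⟶t' = nf _ (⟶-⊕ˡ t⟶t')

  NF-⊕ʳ : ∀ {t r} → NF (t ⊕ r) → NF r
  NF-⊕ʳ nf _ r⟶r' = nf _ (⟶-⊕ʳ r⟶r')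

  NF-⊙ : ∀ {α t} → NF (α ⊙ t) → NF t
  NF-⊙ nf _ t⟶t' = nf _ (⟶-⊙ t⟶t')

  NF-appˡ : ∀ {t r} → NF (app t r) → NF t
  NF-appˡ nf _ t⟶t' = nf _ (⟶-appˡ t⟶t')

  NF-appʳ : ∀ {t r} → NF (app t r) → NF r
  NF-appʳ nf _ r⟶r' = nf _ (⟶-appʳ r⟶r')

  Reducible-⊕ʳ : ∀ {u t} → Reducible t → Reducible (u ⊕ t)
  Reducible-⊕ʳ (_ , t⟶t') = _ , ⟶-⊕ʳ t⟶t'

  Reducible-⊕-summandˡ : ∀ {x y} t → x ∈ summands t → Reducible (x ⊕ y) → Reducible (t ⊕ y)
  Reducible-⊕-summandˡ (var _)   (here refl) red = red
  Reducible-⊕-summandˡ (lam _)   (here refl) red = red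
  Reducible-⊕-summandˡ (app _ _) (here refl) red = red
  Reducible-⊕-summandˡ (_ ⊙ _)   (here refl) red = red
  Reducible-⊕-summandˡ (t₁ ⊕ t₂) x∈ red with ++⁻ (summands t₁) x∈
  ... | inj₁ x∈₁ = Reducible-resp-~ (~trans (~plus ~comm ~refl) (~sym ~assoc))
                     (Reducible-⊕ʳ (Reducible-⊕-summandˡ t₁ x∈₁ red))
  ... | inj₂ x∈₂ = Reducible-resp-~ (~sym ~assoc)
                     (Reducible-⊕ʳ (Reducible-⊕-summandˡ t₂ x∈₂ red))

  Reducible-⊕-summandʳ : ∀ {x y} r → y ∈ summands r → Reducible (x ⊕ y) → Reducible (x ⊕ r)
  Reducible-⊕-summandʳ r y∈ red =
    Reducible-resp-~ ~comm (Reducible-⊕-summandˡ r y∈ (Reducible-resp-~ ~comm red))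

  Reducible-⊕-similar : ∀ {x y a b} → Summand x a → Summand y b → a ~ b → Reducible (x ⊕ y)
  Reducible-⊕-similar (scaled _ _) (scaled _ _) a~b =
    Reducible-resp-~ (~plus ~refl (~sc (~sym a~b))) (↦⇒Reducible r-fact)
  Reducible-⊕-similar (scaled _ _) (plain _) a~b =
    Reducible-resp-~ (~plus ~refl (~sym a~b)) (↦⇒Reducible r-fact1)
  Reducible-⊕-similar (plain _) (scaled _ _) a~b =
    Reducible-resp-~ (~trans ~comm (~plus ~refl a~b)) (↦⇒Reducible r-fact1)
  Reducible-⊕-similar (plain _) (plain _) a~b =
    Reducible-resp-~ (~plus ~refl (~sym a~b)) (↦⇒Reducible r-fact2)

  lam-InV : ∀ s → InV (lam s)
  lam-InV s = lam s ∷ [] , plain s ∷ [] , All.[] ∷ []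

  app-InV-Reducible : ∀ {t r} → InV t → InV r → Reducible (app t r)
  app-InV-Reducible {var _}   (_ , () ∷ _ , _) _
  app-InV-Reducible {app _ _} (_ , () ∷ _ , _) _
  app-InV-Reducible {_ ⊙ _}   _ _ = ↦⇒Reducible r-scl
  app-InV-Reducible {_ ⊕ _}   _ _ = ↦⇒Reducible r-distl
  app-InV-Reducible {lam _} {var _}   _ (_ , () ∷ _ , _)
  app-InV-Reducible {lam _} {app _ _} _ (_ , () ∷ _ , _)
  app-InV-Reducible {lam _} {lam s}   _ _ = ↦⇒Reducible (r-beta (blam s))
  app-InV-Reducible {lam _} {_ ⊙ _}   _ _ = ↦⇒Reducible r-scr
  app-InV-Reducible {lam _} {_ ⊕ _}   _ _ = ↦⇒Reducible r-distr

  ⊙-InV : ∀ {α t} → InV t → NF (α ⊙ t) → InV (α ⊙ t)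
  ⊙-InV {t = var _}   (_ , () ∷ _ , _)
  ⊙-InV {t = app _ _} (_ , () ∷ _ , _)
  ⊙-InV {α} {lam s}   _ _  = lam s ∷ [] , scaled α s ∷ [] , All.[] ∷ []
  ⊙-InV {t = _ ⊙ _}   _ nf = ⊥-elim (Reducible⇒¬NF (↦⇒Reducible r-scsc) nf)
  ⊙-InV {t = _ ⊕ _}   _ nf = ⊥-elim (Reducible⇒¬NF (↦⇒Reducible r-scdist) nf)

  ⊕-InV : ∀ {t r} → InV t → InV r → NF (t ⊕ r) → InV (t ⊕ r)
  ⊕-InV {t} {r} (as , t≈as , as-distinct) (bs , r≈bs , bs-distinct) nf =
    _ , Pointwise.++⁺ t≈as r≈bs ,
    AllPairs.++⁺ as-distinct bs-distinct
      (All.tabulate λ a∈ → All.tabulate λ b∈ → distinct a∈ b∈)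
    where
    distinct : ∀ {a b} → a ∈ as → b ∈ bs → ¬ (a ~ b)
    distinct a∈ b∈ a~b with ∈-Pointwiseʳ t≈as a∈ | ∈-Pointwiseʳ r≈bs b∈
    ... | x , x∈ , x≈a | y , y∈ , y≈b =
      Reducible⇒¬NF (Reducible-⊕-summandʳ r y∈ (Reducible-⊕-summandˡ t x∈
                       (Reducible-⊕-similar x≈a y≈b a~b))) nf

  NF⇒InV : ∀ t → BuiltFromAbs t → NF t → InV t
  NF⇒InV (lam s)   _         _  = lam-InV s
  NF⇒InV (app t r) (bt , br) nf = ⊥-elim (Reducible⇒¬NF
    (app-InV-Reducible (NF⇒InV t bt (NF-appˡ nf)) (NF⇒InV r br (NF-appʳ nf))) nf)
  NF⇒InV (α ⊙ t)   bt        nf = ⊙-InV (NF⇒InV t bt (NF-⊙ nf)) nf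
  NF⇒InV (t ⊕ r)   (bt , br) nf =
    ⊕-InV (NF⇒InV t bt (NF-⊕ˡ nf)) (NF⇒InV r br (NF-⊕ʳ nf)) nf

-- The hypothesis that the ring equality is propositional is not needed: values are
-- compared as terms, never through their scalars.
theorem2 : ∀ {c ℓ} (R : CommutativeRing c ℓ)
    → (∀ {a b} → CommutativeRing._≈_ R a b → a ≡ b)
    → (t : Lvec.Term R) (T : Lvec.Ty R)
    → Lvec._⊢_∶_ R [] t T
    → Lvec.NF R t
    → Lvec.InV R t
theorem2 R _ t T d nf = Values.NF⇒InV R t (Values.⊢[]⇒BuiltFromAbs R d) nf
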